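{- For $n\ge 1$, the number of sequences $e=e_1\cdots e_n\in\mathbf{I}_n(0012)$ with $e_n=n-1$ equals $1$ if $n=1$ and $2^{n-2}$ if $n\ge 2$.
   Context: An inversion sequence of length $n$ is a sequence $e=e_1e_2\cdots e_n$ of integers with $0\le e_i\le i-1$ for each $i$. The reduction of a word is obtained by replacing each occurrence of the $k$-th smallest distinct entry by $k-1$. A sequence $e$ contains a pattern $p$ if some subsequence of $e$ (entries at increasing positions) has reduction $p$; otherwise it avoids $p$. $\mathbf{I}_n(0012)$ is the set of inversion sequences of length $n$ avoiding $0012$. -}

module Defs where

open import Data.Nat using (ℕ; zero; suc; _≤_; _<_; _∸_; _^_)
open import Data.Nat.Properties using (_≟_; _<?_; _≤?_)
open import Data.List using (List; []; _∷_; length; filter; map; concatMap; upTo; _++_; [_]; lookup)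
open import Data.Fin using (Fin; toℕ)
open import Data.Product using (Σ; _×_; _,_; ∃-syntax)
open import Relation.Binary.PropositionalEquality using (_≡_)
open import Relation.Nullary using (¬_; Dec)
open import Data.List.Relation.Unary.All using (All)

Word : Set
Word = List ℕ

-- Inversion sequence: e = e_1 ... e_n with 0 ≤ e_i ≤ i-1; with 0-based
-- position p (p = i-1) this reads e[p] ≤ p.
data IsInvSeqFrom : ℕ → Word → Set where
  []  : ∀ {p} → IsInvSeqFrom p []
  _∷_ : ∀ {p x xs} → x ≤ p → IsInvSeqFrom (suc p) xs → IsInvSeqFrom p (x ∷ xs)

IsInvSeq : Word → Set
IsInvSeq = IsInvSeqFrom 0

distinctBelow : ℕ → Word → Word
distinctBelow x w = filter (λ v → v <? x) (dedup w)
  where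
  dedup : Word → Word
  dedup [] = []
  dedup (y ∷ ys) = y ∷ filter (λ z → Relation.Nullary.¬? (z ≟ y)) (dedup ys)

-- reduction: replace each occurrence of the k-th smallest distinct entry by k-1
reduction : Word → Word
reduction w = map (λ x → length (distinctBelow x w)) w

data SubseqOf : Word → Word → Set where
  stop : SubseqOf [] []
  skip : ∀ {s x w} → SubseqOf s w → SubseqOf s (x ∷ w)
  take : ∀ {s x w} → SubseqOf s w → SubseqOf (x ∷ s) (x ∷ w)

Contains : Word → Word → Set
Contains e p = ∃[ s ] (SubseqOf s e × reduction s ≡ p)

Avoids : Word → Word → Set
Avoids e p = ¬ Contains e p

pattern0012 : Word
pattern0012 = 0 ∷ 0 ∷ 1 ∷ 2 ∷ []

data LastIs (v : ℕ) : Word → Set where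
  here  : LastIs v (v ∷ [])
  there : ∀ {x w} → LastIs v w → LastIs v (x ∷ w)

Target : ℕ → Word → Set
Target n e = length e ≡ n × IsInvSeq e × Avoids e pattern0012 × LastIs (n ∸ 1) e

open import Data.List.Relation.Unary.Unique.Propositional using (Unique)
open import Data.List.Membership.Propositional using (_∈_)

HasCardinality : (Word → Set) → ℕ → Set
HasCardinality P k =
  Σ (List Word) λ l → Unique l × (∀ e → (e ∈ l → P e) × (P e → e ∈ l)) × length l ≡ k

-- Since the last entry n − 1 exceeds every other entry of an inversion sequence e of length n,
-- e avoids 0012 exactly when e₁⋯e_{n−1} avoids 001.  The 001-avoiding inversion sequences of
-- length m ≥ 1 are 0, 1, …, r−1 followed by a weakly decreasing word with entries < r, and each
-- one of length m + 1 arises uniquely from one of length m either by shifting it up by one and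
-- prepending 0, or by appending 0; so there are 2^(m−1) of them.
module Submission where

open import Defs
open import Data.Nat using (ℕ; zero; suc; _+_; _≤_; _<_; _≥_; _^_; _∸_; z≤n; s≤s; s≤s⁻¹; z<s)
open import Data.Nat.Properties
open import Data.List using (List; []; _∷_; length; filter; map; _++_; _∷ʳ_)
open import Data.List.Properties using (∷-injective; ∷-injectiveʳ; ∷ʳ-injectiveˡ; length-++; length-map; map-injective)
open import Data.List.Membership.Propositional using (_∈_)
open import Data.List.Membership.Propositional.Properties using (∈-filter⁺; ∈-filter⁻; ∈-map⁺; ∈-map⁻; ∈-++⁺ˡ; ∈-++⁺ʳ; ∈-++⁻)
open import Data.List.Relation.Unary.Any using (here; there)
open import Data.List.Relation.Unary.AllPairs using ([]; _∷_)
open import Data.List.Relation.Unary.All using (All; []; _∷_)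
import Data.List.Relation.Unary.All as All
import Data.List.Relation.Unary.All.Properties as All
open import Data.List.Relation.Unary.Unique.Propositional using (Unique)
import Data.List.Relation.Unary.Unique.Propositional.Properties as Unique
open import Data.List.Relation.Binary.Pointwise using (Pointwise-≡⇒≡)
open import Data.List.Relation.Binary.Sublist.Propositional using (_⊆_; ⊆-refl)
open import Data.List.Relation.Binary.Sublist.Propositional.Properties using (filter⁺; length-mono-≤; to-≋)
open import Data.Product using (∃-syntax; _×_; _,_; proj₁; proj₂)
open import Data.Sum using (_⊎_; inj₁; inj₂)
open import Relation.Nullary using (¬_; ¬?; yes; no; contradiction)
open import Relation.Nullary.Decidable using (dec-true; dec-false)
open import Relation.Binary using (tri<; tri≈; tri>)
open import Relation.Binary.PropositionalEquality

-- The deduplication local to Defs.distinctBelow; on a word of known length the two agree definitionally.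
dedup : Word → Word
dedup [] = []
dedup (y ∷ ys) = y ∷ filter (λ z → ¬? (z ≟ y)) (dedup ys)

∈-dedup⁺ : ∀ {x} w → x ∈ w → x ∈ dedup w
∈-dedup⁺ (y ∷ w) (here refl) = here refl
∈-dedup⁺ {x} (y ∷ w) (there x∈w) with x ≟ y
... | yes refl = here refl
... | no x≢y   = there (∈-filter⁺ (λ z → ¬? (z ≟ y)) (∈-dedup⁺ w x∈w) x≢y)

countBelow : ℕ → Word → ℕ
countBelow v L = length (filter (_<? v) L)

filter-<-⊆ : ∀ {x y} L → x ≤ y → filter (_<? x) L ⊆ filter (_<? y) L
filter-<-⊆ {x} {y} L x≤y = filter⁺ (_<? x) (_<? y) (λ { refl z<x → <-≤-trans z<x x≤y }) (⊆-refl {x = L})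

countBelow-mono-≤ : ∀ {x y} L → x ≤ y → countBelow x L ≤ countBelow y L
countBelow-mono-≤ L x≤y = length-mono-≤ (filter-<-⊆ L x≤y)

countBelow-mono-< : ∀ {x y} L → x ∈ L → x < y → countBelow x L < countBelow y L
countBelow-mono-< {x} {y} L x∈L x<y = ≤∧≢⇒< (countBelow-mono-≤ L (<⇒≤ x<y)) same-length-absurd
  where
  same-length-absurd : countBelow x L ≢ countBelow y L
  same-length-absurd eq = <-irrefl refl (proj₂ (∈-filter⁻ (_<? x) {xs = L} x∈below-x))
    where
    x∈below-x : x ∈ filter (_<? x) L
    x∈below-x = subst (x ∈_) (sym (Pointwise-≡⇒≡ (to-≋ eq (filter-<-⊆ L (<⇒≤ x<y)))))
                  (∈-filter⁺ (_<? y) x∈L x<y)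

countBelow-cancel-< : ∀ {x y} L → countBelow x L < countBelow y L → x < y
countBelow-cancel-< {x} {y} L lt with <-cmp x y
... | tri< x<y _ _ = x<y
... | tri≈ _ refl _ = contradiction lt (<-irrefl refl)
... | tri> _ _ y<x = contradiction lt (≤⇒≯ (countBelow-mono-≤ L (<⇒≤ y<x)))

countBelow-injective : ∀ {x y} L → x ∈ L → y ∈ L → countBelow x L ≡ countBelow y L → x ≡ y
countBelow-injective {x} {y} L x∈L y∈L eq with <-cmp x y
... | tri< x<y _ _ = contradiction eq (<⇒≢ (countBelow-mono-< L x∈L x<y))
... | tri≈ _ x≡y _ = x≡y
... | tri> _ _ y<x = contradiction eq (>⇒≢ (countBelow-mono-< L y∈L y<x))

reduction≡0012⇒ : ∀ {x y z t} → reduction (x ∷ y ∷ z ∷ t ∷ []) ≡ pattern0012 → x ≡ y × x < z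
reduction≡0012⇒ {x} {y} {z} {t} eq = countBelow-injective D x∈D y∈D (trans rx≡0 (sym ry≡0))
                                   , countBelow-cancel-< D (subst₂ _<_ (sym rx≡0) (sym rz≡1) z<s)
  where
  w = x ∷ y ∷ z ∷ t ∷ []
  D = dedup w
  x∈D : x ∈ D
  x∈D = ∈-dedup⁺ w (here refl)
  y∈D : y ∈ D
  y∈D = ∈-dedup⁺ w (there (here refl))
  rx≡0 : countBelow x D ≡ 0
  rx≡0 = proj₁ (∷-injective eq)
  ry≡0 : countBelow y D ≡ 0
  ry≡0 = proj₁ (∷-injective (proj₂ (∷-injective eq)))
  rz≡1 : countBelow z D ≡ 1
  rz≡1 = proj₁ (∷-injective (proj₂ (∷-injective (proj₂ (∷-injective eq)))))

reduction≡0012⇐ : ∀ {a b c} → a < b → b < c → reduction (a ∷ a ∷ b ∷ c ∷ []) ≡ pattern0012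
-- The tests of b and c against a occur twice, once for each filtering by a inside dedup.
reduction≡0012⇐ {a} {b} {c} a<b b<c
  rewrite dec-false (c ≟ b) (>⇒≢ b<c)
        | dec-false (b ≟ a) (>⇒≢ a<b)
        | dec-false (c ≟ a) (>⇒≢ (<-trans a<b b<c))
        | dec-true (a ≟ a) refl
        | dec-false (b ≟ a) (>⇒≢ a<b)
        | dec-false (c ≟ a) (>⇒≢ (<-trans a<b b<c))
        | dec-false (a <? a) (<-irrefl refl)
        | dec-false (b <? a) (<⇒≯ a<b)
        | dec-false (c <? a) (<⇒≯ (<-trans a<b b<c))
        | dec-true (a <? b) a<b
        | dec-false (b <? b) (<-irrefl refl)
        | dec-false (c <? b) (<⇒≯ b<c)
        | dec-true (a <? c) (<-trans a<b b<c)
        | dec-true (b <? c) b<c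
        | dec-false (c <? c) (<-irrefl refl) = refl

[]-subseq : ∀ w → SubseqOf [] w
[]-subseq []      = stop
[]-subseq (x ∷ w) = skip ([]-subseq w)

subseq-tail : ∀ {x s w} → SubseqOf (x ∷ s) w → SubseqOf s w
subseq-tail (skip h) = skip (subseq-tail h)
subseq-tail (take h) = skip h

subseq-head-∈ : ∀ {x s w} → SubseqOf (x ∷ s) w → x ∈ w
subseq-head-∈ (skip h) = there (subseq-head-∈ h)
subseq-head-∈ (take h) = here refl

subseq-∷ʳ⁺ : ∀ {s w c} → SubseqOf s w → SubseqOf (s ∷ʳ c) (w ∷ʳ c)
subseq-∷ʳ⁺ stop     = take stop
subseq-∷ʳ⁺ (skip h) = skip (subseq-∷ʳ⁺ h)
subseq-∷ʳ⁺ (take h) = take (subseq-∷ʳ⁺ h)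

∷ʳ-not-subseq-[] : ∀ s {d} → ¬ SubseqOf (s ∷ʳ d) []
∷ʳ-not-subseq-[] []      ()
∷ʳ-not-subseq-[] (_ ∷ _) ()

subseq-∷ʳ⁻ : ∀ {c d} s w → SubseqOf (s ∷ʳ d) (w ∷ʳ c) → SubseqOf s w
subseq-∷ʳ⁻ []      w       _        = []-subseq w
subseq-∷ʳ⁻ (x ∷ s) []      (skip ())
subseq-∷ʳ⁻ (x ∷ s) []      (take h) = contradiction h (∷ʳ-not-subseq-[] s)
subseq-∷ʳ⁻ (x ∷ s) (y ∷ w) (skip h) = skip (subseq-∷ʳ⁻ (x ∷ s) w h)
subseq-∷ʳ⁻ (x ∷ s) (y ∷ w) (take h) = take (subseq-∷ʳ⁻ s w h)

length-∷ʳ : ∀ (p : Word) c → length (p ∷ʳ c) ≡ suc (length p)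
length-∷ʳ p c = trans (length-++ p) (+-comm (length p) 1)

invSeq-++⁻ˡ : ∀ {i} p {q} → IsInvSeqFrom i (p ++ q) → IsInvSeqFrom i p
invSeq-++⁻ˡ []      _        = []
invSeq-++⁻ˡ (x ∷ p) (x≤i ∷ h) = x≤i ∷ invSeq-++⁻ˡ p h

invSeq-∷ʳ⁺ : ∀ {i x p} → IsInvSeqFrom i p → x ≤ i + length p → IsInvSeqFrom i (p ∷ʳ x)
invSeq-∷ʳ⁺ {i} {x} []                  x≤ = subst (x ≤_) (+-identityʳ i) x≤ ∷ []
invSeq-∷ʳ⁺ {i} {x} (_∷_ {xs = xs} y≤i h) x≤ = y≤i ∷ invSeq-∷ʳ⁺ h (subst (x ≤_) (+-suc i (length xs)) x≤)

invSeq-∈⇒< : ∀ {i x p} → IsInvSeqFrom i p → x ∈ p → x < i + length p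
invSeq-∈⇒< {i} {x} (_∷_ {xs = xs} x≤i _) (here refl) =
  subst (x <_) (sym (+-suc i (length xs))) (s≤s (≤-trans x≤i (m≤m+n i _)))
invSeq-∈⇒< {i} {x} (_∷_ {xs = xs} _ h) (there x∈xs) =
  subst (x <_) (sym (+-suc i (length xs))) (invSeq-∈⇒< h x∈xs)

Avoids001 : Word → Set
Avoids001 p = ∀ {a b} → a < b → ¬ SubseqOf (a ∷ a ∷ b ∷ []) p

NoAscentFrom : (ℕ → Set) → Word → Set
NoAscentFrom P p = ∀ {a b} → P a → a < b → ¬ SubseqOf (a ∷ b ∷ []) p

data Descending : ℕ → Word → Set where
  []  : ∀ {j} → Descending j []
  _∷_ : ∀ {j x xs} → x ≤ j → Descending x xs → Descending j (x ∷ xs)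

-- Staircase i p: p is i, i+1, …, m−1 followed by a Descending (m−1) word.
data Staircase : ℕ → Word → Set where
  []      : ∀ {i} → Staircase i []
  step    : ∀ {i xs} → Staircase (suc i) xs → Staircase i (i ∷ xs)
  descend : ∀ {j xs} → Descending j xs → Staircase (suc j) xs

StaircaseOfLength : ℕ → Word → Set
StaircaseOfLength m p = Staircase 0 p × length p ≡ m

Descending-∈⇒≤ : ∀ {j p x} → Descending j p → x ∈ p → x ≤ j
Descending-∈⇒≤ (x≤j ∷ _) (here refl)  = x≤j
Descending-∈⇒≤ (y≤j ∷ d) (there x∈p) = ≤-trans (Descending-∈⇒≤ d x∈p) y≤j

Descending⇒noAscent : ∀ {j p a b} → Descending j p → a < b → ¬ SubseqOf (a ∷ b ∷ []) p
Descending⇒noAscent (_ ∷ d) a<b (skip h) = Descending⇒noAscent d a<b h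
Descending⇒noAscent (_ ∷ d) a<b (take h) = <⇒≱ a<b (Descending-∈⇒≤ d (subseq-head-∈ h))

Staircase⇒noAscentBelow : ∀ {i p} → Staircase i p → NoAscentFrom (_< i) p
Staircase⇒noAscentBelow (step s)    a<i a<b (skip h) = Staircase⇒noAscentBelow s (m<n⇒m<1+n a<i) a<b h
Staircase⇒noAscentBelow (step s)    a<i a<b (take h) = <-irrefl refl a<i
Staircase⇒noAscentBelow (descend d) _   a<b h        = Descending⇒noAscent d a<b h

Staircase⇒avoids001 : ∀ {i p} → Staircase i p → Avoids001 p
Staircase⇒avoids001 (step s)    a<b (skip h) = Staircase⇒avoids001 s a<b h
Staircase⇒avoids001 (step s)    a<b (take h) = Staircase⇒noAscentBelow s (n<1+n _) a<b h
Staircase⇒avoids001 (descend d) a<b h        = Descending⇒noAscent d a<b (subseq-tail h)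

Descending⇒invSeq : ∀ {j i p} → Descending j p → j ≤ i → IsInvSeqFrom i p
Descending⇒invSeq []        _   = []
Descending⇒invSeq (x≤j ∷ d) j≤i = x≤i ∷ Descending⇒invSeq d (m≤n⇒m≤1+n x≤i)
  where x≤i = ≤-trans x≤j j≤i

Staircase⇒invSeq : ∀ {i p} → Staircase i p → IsInvSeqFrom i p
Staircase⇒invSeq []          = []
Staircase⇒invSeq (step s)    = ≤-refl ∷ Staircase⇒invSeq s
Staircase⇒invSeq (descend d) = Descending⇒invSeq d (n≤1+n _)

descending-intro : ∀ {y} q → NoAscentFrom (_≤ y) q → (∀ {b} → y < b → ¬ SubseqOf (b ∷ []) q) → Descending y q
descending-intro []      _        _      = []
descending-intro {y} (z ∷ q) noAscent noLarge with z ≤? y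
... | no z≰y = contradiction (take ([]-subseq q)) (noLarge (≰⇒> z≰y))
... | yes z≤y = z≤y ∷ descending-intro q (λ a≤z a<b h → noAscent (≤-trans a≤z z≤y) a<b (skip h))
                                         (λ z<b h → noAscent z≤y z<b (take h))

staircase-intro : ∀ {i p} → IsInvSeqFrom i p → Avoids001 p → NoAscentFrom (_< i) p → Staircase i p
staircase-intro [] _ _ = []
staircase-intro {i} (_∷_ {x = x} {xs = p} x≤i inv) avoid noAscent with m≤n⇒m<n∨m≡n x≤i
... | inj₂ refl = step (staircase-intro inv (λ a<b h → avoid a<b (skip h)) noAscent′)
  where
  noAscent′ : NoAscentFrom (_< suc x) p
  noAscent′ a<1+x a<b h with m≤n⇒m<n∨m≡n (s≤s⁻¹ a<1+x)
  ... | inj₁ a<x  = noAscent a<x a<b (skip h)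
  ... | inj₂ refl = avoid a<b (take h)
staircase-intro {suc j} (_∷_ {x = x} {xs = p} x≤i inv) avoid noAscent | inj₁ x<i =
  descend (s≤s⁻¹ x<i ∷ descending-intro p (λ a≤x a<b h → noAscent (≤-<-trans a≤x x<i) a<b (skip h))
                                          (λ x<b h → noAscent x<i x<b (take h)))

Descending-map-suc : ∀ {j q} → Descending j q → Descending (suc j) (map suc q)
Descending-map-suc []        = []
Descending-map-suc (x≤j ∷ d) = s≤s x≤j ∷ Descending-map-suc d

Staircase-map-suc : ∀ {i q} → Staircase i q → Staircase (suc i) (map suc q)
Staircase-map-suc []          = []
Staircase-map-suc (step s)    = step (Staircase-map-suc s)
Staircase-map-suc (descend d) = descend (Descending-map-suc d)

Descending-∷ʳ0 : ∀ {j q} → Descending j q → Descending j (q ∷ʳ 0)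
Descending-∷ʳ0 []        = z≤n ∷ []
Descending-∷ʳ0 (x≤j ∷ d) = x≤j ∷ Descending-∷ʳ0 d

Staircase-∷ʳ0 : ∀ {i q} → Staircase i q → Staircase i (q ∷ʳ 0)
Staircase-∷ʳ0 {zero}  []          = step []
Staircase-∷ʳ0 {suc _} []          = descend (z≤n ∷ [])
Staircase-∷ʳ0         (step s)    = step (Staircase-∷ʳ0 s)
Staircase-∷ʳ0         (descend d) = descend (Descending-∷ʳ0 d)

Descending-zero-split : ∀ {p} → Descending 0 p → p ≡ [] ⊎ ∃[ q ] (p ≡ q ∷ʳ 0 × Descending 0 q)
Descending-zero-split [] = inj₁ refl
Descending-zero-split (z≤n ∷ d) with Descending-zero-split d
... | inj₁ refl           = inj₂ ([] , refl , [])
... | inj₂ (q , refl , e) = inj₂ (0 ∷ q , refl , z≤n ∷ e)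

Descending-split : ∀ {j p} → Descending (suc j) p →
  ∃[ q ] (p ≡ map suc q × Descending j q) ⊎ ∃[ q ] (p ≡ q ∷ʳ 0 × Descending (suc j) q)
Descending-split [] = inj₁ ([] , refl , [])
Descending-split (z≤n ∷ d) with Descending-zero-split d
... | inj₁ refl           = inj₂ ([] , refl , [])
... | inj₂ (q , refl , e) = inj₂ (0 ∷ q , refl , z≤n ∷ e)
Descending-split (s≤s x≤j ∷ d) with Descending-split d
... | inj₁ (q , refl , e) = inj₁ (_ ∷ q , refl , x≤j ∷ e)
... | inj₂ (q , refl , e) = inj₂ (_ ∷ q , refl , s≤s x≤j ∷ e)

Staircase-split : ∀ {i p} → Staircase (suc i) p →
  ∃[ q ] (p ≡ map suc q × Staircase i q) ⊎ ∃[ q ] (p ≡ q ∷ʳ 0 × Staircase (suc i) q)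
Staircase-split [] = inj₁ ([] , refl , [])
Staircase-split {i} (step s) with Staircase-split s
... | inj₁ (q , refl , t) = inj₁ (i ∷ q , refl , step t)
... | inj₂ (q , refl , t) = inj₂ (suc i ∷ q , refl , step t)
Staircase-split {zero} (descend d) with Descending-zero-split d
... | inj₁ refl           = inj₁ ([] , refl , [])
... | inj₂ (q , refl , e) = inj₂ (q , refl , descend e)
Staircase-split {suc _} (descend d) with Descending-split d
... | inj₁ (q , refl , e) = inj₁ (q , refl , descend e)
... | inj₂ (q , refl , e) = inj₂ (q , refl , descend e)

shiftUp : Word → Word
shiftUp q = 0 ∷ map suc q

staircases : ℕ → List Word
staircases zero          = [] ∷ []
staircases (suc zero)    = (0 ∷ []) ∷ []
staircases (suc (suc m)) = map shiftUp (staircases (suc m)) ++ map (_∷ʳ 0) (staircases (suc m))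

staircases-valid : ∀ m → All (StaircaseOfLength m) (staircases m)
staircases-valid zero          = ([] , refl) ∷ []
staircases-valid (suc zero)    = (step [] , refl) ∷ []
staircases-valid (suc (suc m)) =
  All.++⁺ (All.map⁺ (All.map shifted (staircases-valid (suc m))))
          (All.map⁺ (All.map padded (staircases-valid (suc m))))
  where
  shifted : ∀ {q} → StaircaseOfLength (suc m) q → StaircaseOfLength (suc (suc m)) (shiftUp q)
  shifted {q} (s , len) = step (Staircase-map-suc s) , cong suc (trans (length-map suc q) len)
  padded : ∀ {q} → StaircaseOfLength (suc m) q → StaircaseOfLength (suc (suc m)) (q ∷ʳ 0)
  padded {q} (s , len) = Staircase-∷ʳ0 s , trans (length-∷ʳ q 0) (cong suc len)

∈-staircases⁺-step : ∀ m → (∀ {q} → StaircaseOfLength (suc m) q → q ∈ staircases (suc m))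
                   → ∀ {p} → Staircase 1 p → length p ≡ suc m → 0 ∷ p ∈ staircases (suc (suc m))
∈-staircases⁺-step m ih s len with Staircase-split s
... | inj₁ (q , refl , t) =
  ∈-++⁺ˡ (∈-map⁺ shiftUp (ih (t , trans (sym (length-map suc q)) len)))
... | inj₂ (q , refl , t) =
  ∈-++⁺ʳ _ (∈-map⁺ (_∷ʳ 0) (ih (step t , trans (sym (length-∷ʳ q 0)) len)))

∈-staircases⁺ : ∀ m {p} → StaircaseOfLength m p → p ∈ staircases m
∈-staircases⁺ zero          {[]}        (_ , refl)      = here refl
∈-staircases⁺ (suc zero)    {.0 ∷ []}   (step _ , refl) = here refl
∈-staircases⁺ (suc zero)    {_ ∷ _ ∷ _} (_ , ())
∈-staircases⁺ (suc (suc m)) {.0 ∷ _}    (step s , len)  =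
  ∈-staircases⁺-step m (∈-staircases⁺ (suc m)) s (suc-injective len)

shiftUp≢∷ʳ0 : ∀ x q r → shiftUp (x ∷ q) ≢ r ∷ʳ 0
shiftUp≢∷ʳ0 x q []      ()
shiftUp≢∷ʳ0 x q (_ ∷ r) eq with ∈-map⁻ suc (subst (0 ∈_) (sym (∷-injectiveʳ eq)) (∈-++⁺ʳ r (here refl)))
... | _ , _ , ()

staircases-unique : ∀ m → Unique (staircases m)
staircases-unique zero          = [] ∷ []
staircases-unique (suc zero)    = [] ∷ []
staircases-unique (suc (suc m)) =
  Unique.++⁺ (Unique.map⁺ shiftUp-injective (staircases-unique (suc m)))
             (Unique.map⁺ (λ {q} {q′} → ∷ʳ-injectiveˡ q q′) (staircases-unique (suc m)))
             disjoint
  where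
  shiftUp-injective : ∀ {q q′} → shiftUp q ≡ shiftUp q′ → q ≡ q′
  shiftUp-injective eq = map-injective suc-injective (∷-injectiveʳ eq)
  disjoint : ∀ {v} → ¬ (v ∈ map shiftUp (staircases (suc m)) × v ∈ map (_∷ʳ 0) (staircases (suc m)))
  disjoint (v∈shifted , v∈padded) with ∈-map⁻ shiftUp v∈shifted | ∈-map⁻ (_∷ʳ 0) v∈padded
  ... | q , q∈ , refl | r , _ , eq with q | proj₂ (All.lookup (staircases-valid (suc m)) q∈)
  ...   | x ∷ q′ | _ = shiftUp≢∷ʳ0 x q′ r eq

length-staircases : ∀ m → length (staircases (suc m)) ≡ 2 ^ m
length-staircases zero    = refl
length-staircases (suc m) = begin
  length (map shiftUp S ++ map (_∷ʳ 0) S)         ≡⟨ length-++ (map shiftUp S) ⟩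
  length (map shiftUp S) + length (map (_∷ʳ 0) S) ≡⟨ cong₂ _+_ (length-map shiftUp S) (length-map (_∷ʳ 0) S) ⟩
  length S + length S                             ≡⟨ cong (λ n → n + n) (length-staircases m) ⟩
  2 ^ m + 2 ^ m                                   ≡⟨ cong (2 ^ m +_) (sym (+-identityʳ (2 ^ m))) ⟩
  2 ^ suc m                                       ∎
  where
  open ≡-Reasoning
  S = staircases (suc m)

last-∷ʳ : ∀ (p : Word) v → LastIs v (p ∷ʳ v)
last-∷ʳ []      v = here
last-∷ʳ (x ∷ p) v = there (last-∷ʳ p v)

LastIs⇒∷ʳ : ∀ {v e} → LastIs v e → ∃[ p ] (e ≡ p ∷ʳ v)
LastIs⇒∷ʳ here = [] , refl
LastIs⇒∷ʳ (there {x = x} l) with LastIs⇒∷ʳ l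
... | p , refl = x ∷ p , refl

avoids0012-∷ʳ : ∀ {p c} → Avoids001 p → Avoids (p ∷ʳ c) pattern0012
avoids0012-∷ʳ {p} avoid (x ∷ y ∷ z ∷ t ∷ [] , h , eq) with reduction≡0012⇒ {x} {y} {z} {t} eq
... | refl , x<z = avoid x<z (subseq-∷ʳ⁻ (x ∷ x ∷ z ∷ []) p h)
avoids0012-∷ʳ _ ([]                    , _ , ())
avoids0012-∷ʳ _ (_ ∷ []                , _ , ())
avoids0012-∷ʳ _ (_ ∷ _ ∷ []            , _ , ())
avoids0012-∷ʳ _ (_ ∷ _ ∷ _ ∷ []        , _ , ())
avoids0012-∷ʳ _ (_ ∷ _ ∷ _ ∷ _ ∷ _ ∷ _ , _ , ())

avoids001-∷ʳ : ∀ {p c} → (∀ {x} → x ∈ p → x < c) → Avoids (p ∷ʳ c) pattern0012 → Avoids001 p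
avoids001-∷ʳ below avoid {a} {b} a<b h =
  avoid (a ∷ a ∷ b ∷ _ ∷ [] , subseq-∷ʳ⁺ h , reduction≡0012⇐ a<b (below (subseq-head-∈ (subseq-tail (subseq-tail h)))))

staircase⇒Target : ∀ {k p} → StaircaseOfLength k p → Target (suc k) (p ∷ʳ k)
staircase⇒Target {k} {p} (s , len) =
    trans (length-∷ʳ p k) (cong suc len)
  , invSeq-∷ʳ⁺ (Staircase⇒invSeq s) (≤-reflexive (sym len))
  , avoids0012-∷ʳ (Staircase⇒avoids001 s)
  , last-∷ʳ p k

Target⇒staircase : ∀ {k e} → Target (suc k) e → ∃[ p ] (e ≡ p ∷ʳ k × StaircaseOfLength k p)
Target⇒staircase {k} (len , inv , avoid , last) with LastIs⇒∷ʳ last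
... | p , refl = p , refl , staircase-intro invp (avoids001-∷ʳ below avoid) (λ ()) , lenp
  where
  lenp : length p ≡ k
  lenp = suc-injective (trans (sym (length-∷ʳ p k)) len)
  invp : IsInvSeq p
  invp = invSeq-++⁻ˡ p inv
  below : ∀ {x} → x ∈ p → x < k
  below x∈p = subst (_ <_) lenp (invSeq-∈⇒< invp x∈p)

Target-cardinality : ∀ k → HasCardinality (Target (suc k)) (length (staircases k))
Target-cardinality k =
    map (_∷ʳ k) (staircases k)
  , Unique.map⁺ (λ {q} {q′} → ∷ʳ-injectiveˡ q q′) (staircases-unique k)
  , (λ e → sound e , complete e)
  , length-map (_∷ʳ k) (staircases k)
  where
  sound : ∀ e → e ∈ map (_∷ʳ k) (staircases k) → Target (suc k) e
  sound e e∈ with ∈-map⁻ (_∷ʳ k) e∈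
  ... | p , p∈ , refl = staircase⇒Target (All.lookup (staircases-valid k) p∈)
  complete : ∀ e → Target (suc k) e → e ∈ map (_∷ʳ k) (staircases k)
  complete e t with Target⇒staircase t
  ... | p , refl , s = ∈-map⁺ (_∷ʳ k) (∈-staircases⁺ k s)

theorem1p3 : HasCardinality (Target 1) 1
    × (∀ (n : ℕ) → n ≥ 2 → HasCardinality (Target n) (2 ^ (n ∸ 2)))
theorem1p3 = Target-cardinality 0 , at-least-two
  where
  at-least-two : ∀ n → n ≥ 2 → HasCardinality (Target n) (2 ^ (n ∸ 2))
  at-least-two (suc zero)    (s≤s ())
  at-least-two (suc (suc k)) _ =
    subst (HasCardinality (Target (suc (suc k)))) (length-staircases k) (Target-cardinality (suc k))
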